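{- Let $A$ and $B$ be propositions of the $\odot$-calculus. If there is a closed proof-term $t$ with $\vdash t : A\vee B$ (empty context), then there is a closed proof-term $u$ with $\vdash u : A$ or there is a closed proof-term $u$ with $\vdash u : B$.
   Context: The $\odot$-calculus. Propositions: $A ::= \top \mid \bot \mid A \Rightarrow A \mid A \wedge A \mid A \vee A \mid A \odot A$. Proof-terms: $t ::= x \mid t \parallel u \mid * \mid \delta_\bot(t) \mid \lambda x\, t \mid t\,u \mid \langle t,u\rangle \mid \delta_\wedge(t,[x,y]u) \mid \mathrm{inl}(t) \mid \mathrm{inr}(t) \mid \delta_\vee(t,[x]u,[y]v) \mid t+u \mid \delta_\odot(t,[x]u,[y]v) \mid \delta_\odot^\parallel(t,[x]u,[y]v)$, where $\lambda x$ binds $x$, $[x,y]$ binds $x,y$, and $[x]$, $[y]$ bind $x$, $y$; a term is closed if it has no free variables. Typing rules: $\Gamma\vdash x:A$ if $x:A\in\Gamma$; from $\Gamma\vdash t:A$ and $\Gamma\vdash u:A$ infer $\Gamma\vdash t\parallel u:A$; $\Gamma\vdash *:\top$; from $\Gamma\vdash t:\bot$ infer $\Gamma\vdash\delta_\bot(t):C$; from $\Gamma,x:A\vdash t:B$ infer $\Gamma\vdash\lambda x\,t:A\Rightarrow B$; from $\Gamma\vdash t:A\Rightarrow B$ and $\Gamma\vdash u:A$ infer $\Gamma\vdash t\,u:B$; from $\Gamma\vdash t:A$, $\Gamma\vdash u:B$ infer $\Gamma\vdash\langle t,u\rangle:A\wedge B$; from $\Gamma\vdash t:A\wedge B$ and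 $\Gamma,x:A,y:B\vdash u:C$ infer $\Gamma\vdash\delta_\wedge(t,[x,y]u):C$; from $\Gamma\vdash t:A$ infer $\Gamma\vdash\mathrm{inl}(t):A\vee B$; from $\Gamma\vdash t:B$ infer $\Gamma\vdash\mathrm{inr}(t):A\vee B$; from $\Gamma\vdash t:A\vee B$, $\Gamma,x:A\vdash u:C$, $\Gamma,y:B\vdash v:C$ infer $\Gamma\vdash\delta_\vee(t,[x]u,[y]v):C$; from $\Gamma\vdash t:A$, $\Gamma\vdash u:B$ infer $\Gamma\vdash t+u:A\odot B$; from $\Gamma\vdash t:A\odot B$, $\Gamma,x:A\vdash u:C$, $\Gamma,y:B\vdash v:C$ infer both $\Gamma\vdash\delta_\odot(t,[x]u,[y]v):C$ and $\Gamma\vdash\delta_\odot^\parallel(t,[x]u,[y]v):C$. -}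

module Defs where

open import Data.Nat using (ℕ; suc)
open import Data.Fin using (Fin)
open import Data.Vec using (Vec; []; _∷_; lookup)
open import Relation.Binary.PropositionalEquality using (_≡_)

infixr 5 _⇒_
infixr 6 _∨_ _⊙_
infixr 7 _∧_

data Prop : Set where
  ⊤ᵖ ⊥ᵖ : Prop
  _⇒_ _∧_ _∨_ _⊙_ : Prop → Prop → Prop

-- A binder [x] u is represented by a body in Term (suc n); [x,y] u by a body
-- in Term (suc (suc n)) where index 0 is y and index 1 is x.
data Term (n : ℕ) : Set where
  var   : Fin n → Term n
  _∥_   : Term n → Term n → Term n
  star  : Term n
  δ⊥    : Term n → Term n
  lam   : Term (suc n) → Term n
  app   : Term n → Term n → Term n
  pair  : Term n → Term n → Term n
  δ∧    : Term n → Term (suc (suc n)) → Term n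
  inl   : Term n → Term n
  inr   : Term n → Term n
  δ∨    : Term n → Term (suc n) → Term (suc n) → Term n
  _⊕_   : Term n → Term n → Term n
  δ⊙    : Term n → Term (suc n) → Term (suc n) → Term n
  δ⊙∥   : Term n → Term (suc n) → Term (suc n) → Term n

Ctx : ℕ → Set
Ctx n = Vec Prop n

infix 4 _⊢_∶_

data _⊢_∶_ {n : ℕ} (Γ : Ctx n) : Term n → Prop → Set where
  ax    : ∀ {x A} → lookup Γ x ≡ A → Γ ⊢ var x ∶ A
  par   : ∀ {t u A} → Γ ⊢ t ∶ A → Γ ⊢ u ∶ A → Γ ⊢ t ∥ u ∶ A
  ⊤i    : Γ ⊢ star ∶ ⊤ᵖ
  ⊥e    : ∀ {t C} → Γ ⊢ t ∶ ⊥ᵖ → Γ ⊢ δ⊥ t ∶ C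
  ⇒i    : ∀ {t A B} → (A ∷ Γ) ⊢ t ∶ B → Γ ⊢ lam t ∶ A ⇒ B
  ⇒e    : ∀ {t u A B} → Γ ⊢ t ∶ A ⇒ B → Γ ⊢ u ∶ A → Γ ⊢ app t u ∶ B
  ∧i    : ∀ {t u A B} → Γ ⊢ t ∶ A → Γ ⊢ u ∶ B → Γ ⊢ pair t u ∶ A ∧ B
  ∧e    : ∀ {t u A B C} → Γ ⊢ t ∶ A ∧ B → (B ∷ A ∷ Γ) ⊢ u ∶ C → Γ ⊢ δ∧ t u ∶ C
  ∨i₁   : ∀ {t A B} → Γ ⊢ t ∶ A → Γ ⊢ inl t ∶ A ∨ B
  ∨i₂   : ∀ {t A B} → Γ ⊢ t ∶ B → Γ ⊢ inr t ∶ A ∨ B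
  ∨e    : ∀ {t u v A B C} → Γ ⊢ t ∶ A ∨ B → (A ∷ Γ) ⊢ u ∶ C → (B ∷ Γ) ⊢ v ∶ C
          → Γ ⊢ δ∨ t u v ∶ C
  ⊙i    : ∀ {t u A B} → Γ ⊢ t ∶ A → Γ ⊢ u ∶ B → Γ ⊢ t ⊕ u ∶ A ⊙ B
  ⊙e    : ∀ {t u v A B C} → Γ ⊢ t ∶ A ⊙ B → (A ∷ Γ) ⊢ u ∶ C → (B ∷ Γ) ⊢ v ∶ C
          → Γ ⊢ δ⊙ t u v ∶ C
  ⊙e∥   : ∀ {t u v A B C} → Γ ⊢ t ∶ A ⊙ B → (A ∷ Γ) ⊢ u ∶ C → (B ∷ Γ) ⊢ v ∶ C
          → Γ ⊢ δ⊙∥ t u v ∶ C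

Closed : Set
Closed = Term 0

{-# OPTIONS --safe #-}
-- Realizability glued with provability.  Interpret each proposition as a set
-- of realizers, where a realizer of A ⇒ B also carries a closed proof of A ⇒ B;
-- every realizer then reifies to a closed proof.  Every derivation is sound
-- for this interpretation, and a realizer of A ∨ B is a realizer of A or of B,
-- so its reification is a closed proof of A or of B.
module Submission where

open import Defs
open import Data.Fin using (Fin; zero; suc)
open import Data.Vec using ([]; _∷_; lookup)
open import Data.Product using (Σ-syntax; _×_; _,_; proj₁; proj₂)
open import Data.Sum using (_⊎_; inj₁; inj₂; [_,_])
import Data.Sum as Sum
open import Data.Unit using () renaming (⊤ to Unit; tt to unit)
open import Data.Empty using (⊥-elim) renaming (⊥ to Empty)
open import Relation.Binary.PropositionalEquality using (refl)

Provable : Prop → Set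
Provable A = Σ[ u ∈ Closed ] [] ⊢ u ∶ A

ProvableCtx : ∀ {n} → Ctx n → Set
ProvableCtx {n} Γ = (i : Fin n) → Provable (lookup Γ i)

-- Abstract the last hypothesis and apply the result to its closed proof,
-- so no substitution lemma is needed.
provable-under-provableCtx : ∀ {n} (Γ : Ctx n) {t A} →
                             Γ ⊢ t ∶ A → ProvableCtx Γ → Provable A
provable-under-provableCtx []      {t} d _ = t , d
provable-under-provableCtx (B ∷ Γ)     d π =
  let f , df = provable-under-provableCtx Γ (⇒i d) (λ i → π (suc i))
      b , db = π zero
  in  app f b , ⇒e df db

-- A ⊙ B is realized like A ∧ B, so both of its eliminators can be
-- interpreted by the left branch.
⟦_⟧ : Prop → Set
⟦ ⊤ᵖ ⟧    = Unit
⟦ ⊥ᵖ ⟧    = Empty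
⟦ A ⇒ B ⟧ = Provable (A ⇒ B) × (⟦ A ⟧ → ⟦ B ⟧)
⟦ A ∧ B ⟧ = ⟦ A ⟧ × ⟦ B ⟧
⟦ A ∨ B ⟧ = ⟦ A ⟧ ⊎ ⟦ B ⟧
⟦ A ⊙ B ⟧ = ⟦ A ⟧ × ⟦ B ⟧

reify : ∀ A → ⟦ A ⟧ → Provable A
reify ⊤ᵖ      _            = star , ⊤i
reify (A ⇒ B) (p , _)      = p
reify (A ∧ B) (a , b)      = let x , dx = reify A a; y , dy = reify B b
                             in  pair x y , ∧i dx dy
reify (A ∨ B) (inj₁ a)     = let x , dx = reify A a in inl x , ∨i₁ dx
reify (A ∨ B) (inj₂ b)     = let y , dy = reify B b in inr y , ∨i₂ dy
reify (A ⊙ B) (a , b)      = let x , dx = reify A a; y , dy = reify B b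
                             in  x ⊕ y , ⊙i dx dy

Env : ∀ {n} → Ctx n → Set
Env {n} Γ = (i : Fin n) → ⟦ lookup Γ i ⟧

infixr 5 _∷ᵉ_

_∷ᵉ_ : ∀ {n} {Γ : Ctx n} {A} → ⟦ A ⟧ → Env Γ → Env (A ∷ Γ)
(a ∷ᵉ ρ) zero    = a
(a ∷ᵉ ρ) (suc i) = ρ i

reifyEnv : ∀ {n} (Γ : Ctx n) → Env Γ → ProvableCtx Γ
reifyEnv Γ ρ i = reify (lookup Γ i) (ρ i)

soundness : ∀ {n} {Γ : Ctx n} {t A} → Γ ⊢ t ∶ A → Env Γ → ⟦ A ⟧
soundness         (ax {x} refl) ρ = ρ x
soundness         (par d _)     ρ = soundness d ρ
soundness         ⊤i            ρ = unit
soundness         (⊥e d)        ρ = ⊥-elim (soundness d ρ)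
soundness {Γ = Γ} (⇒i d)        ρ =
  provable-under-provableCtx Γ (⇒i d) (reifyEnv Γ ρ) , λ a → soundness d (a ∷ᵉ ρ)
soundness         (⇒e d e)      ρ = proj₂ (soundness d ρ) (soundness e ρ)
soundness         (∧i d e)      ρ = soundness d ρ , soundness e ρ
soundness         (∧e d e)      ρ = let a , b = soundness d ρ in soundness e (b ∷ᵉ a ∷ᵉ ρ)
soundness         (∨i₁ d)       ρ = inj₁ (soundness d ρ)
soundness         (∨i₂ d)       ρ = inj₂ (soundness d ρ)
soundness         (∨e d u v)    ρ =
  [ (λ a → soundness u (a ∷ᵉ ρ)) , (λ b → soundness v (b ∷ᵉ ρ)) ] (soundness d ρ)
soundness         (⊙i d e)      ρ = soundness d ρ , soundness e ρ
soundness         (⊙e d u _)    ρ = soundness u (proj₁ (soundness d ρ) ∷ᵉ ρ)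
soundness         (⊙e∥ d u _)   ρ = soundness u (proj₁ (soundness d ρ) ∷ᵉ ρ)

mainTheorem3 : (A B : Prop) (t : Closed) → [] ⊢ t ∶ A ∨ B
    → (Σ[ u ∈ Closed ] [] ⊢ u ∶ A) ⊎ (Σ[ u ∈ Closed ] [] ⊢ u ∶ B)
mainTheorem3 A B t d = Sum.map (reify A) (reify B) (soundness d (λ ()))
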